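{- Let $a,b$ be integers with $a-1>b\ge 1$, let $\varphi(0)=0^a1$, $\varphi(1)=0^b1$ define a morphism of $\{0,1\}^*$, let $u_\beta=\lim_{n\to\infty}\varphi^n(0)$, and for a finite word $w$ put $T(w)=0^b1\varphi(w)0^b$. Let $p\in{\cal L}(u_\beta)$. Then $p$ is a palindrome if and only if $T(p)$ is a palindrome in $u_\beta$. Moreover, $$\{z\in\{0,1\}: zpz\in{\cal L}(u_\beta)\}=\{z\in\{0,1\}: zT(p)z\in{\cal L}(u_\beta)\}.$$
   Context: ${\cal L}(u_\beta)$ is the set of finite factors of $u_\beta$; for $w\in{\cal L}(u_\beta)$ one has $T(w)\in{\cal L}(u_\beta)$. For $w=w_1\cdots w_n$, $\overline{w}=w_n\cdots w_1$, and $w$ is a palindrome if $w=\overline w$. -}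

module Defs where

open import Data.Nat using (ℕ; zero; suc; _+_)
open import Data.List using (List; []; _∷_; _++_; replicate; concatMap; reverse; map; upTo; length)
open import Data.Product using (∃)
open import Relation.Binary.PropositionalEquality using (_≡_)

data Letter : Set where
  𝟘 𝟙 : Letter

Word : Set
Word = List Letter

φ-letter : ℕ → ℕ → Letter → Word
φ-letter a b 𝟘 = replicate a 𝟘 ++ (𝟙 ∷ [])
φ-letter a b 𝟙 = replicate b 𝟘 ++ (𝟙 ∷ [])

φ : ℕ → ℕ → Word → Word
φ a b w = concatMap (φ-letter a b) w

φ^ : ℕ → ℕ → ℕ → Word → Word
φ^ a b zero    w = w
φ^ a b (suc n) w = φ a b (φ^ a b n w)

-- k-th letter of a word (0-indexed), with default 𝟘 if out of range
at : Word → ℕ → Letter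
at []      k       = 𝟘
at (x ∷ w) zero    = x
at (x ∷ w) (suc k) = at w k

-- u_β = lim φ^n(0).  Since φ(0) starts with 0, φ^n(0) is a prefix of
-- φ^(n+1)(0), and |φ^(k+1)(0)| ≥ k+2 when a ≥ 1, so the k-th letter of the
-- limit is the k-th letter of φ^(k+1)(0).
uβ : ℕ → ℕ → ℕ → Letter
uβ a b k = at (φ^ a b (suc k) (𝟘 ∷ [])) k

factorAt : (ℕ → Letter) → ℕ → ℕ → Word
factorAt u i n = map (λ j → u (i + j)) (upTo n)

_∈𝓛_ : Word → (ℕ → Letter) → Set
w ∈𝓛 u = ∃ λ i → w ≡ factorAt u i (length w)

Palindrome : Word → Set
Palindrome w = w ≡ reverse w

T : ℕ → ℕ → Word → Word
T a b w = replicate b 𝟘 ++ (𝟙 ∷ φ a b w) ++ replicate b 𝟘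

{-# OPTIONS --safe #-}
-- Since φ(c) = 0^{e(c)} 1 with e(𝟘) = a ≠ b = e(𝟙), φ is a prefix code: it is injective and every
-- 𝟙 of φ(w) closes a block φ(c).  Two identities drive the proof:
--   𝟙 T(p) 𝟙 = 𝟙 φ(𝟙 p 𝟙)   and   𝟘 T(p) 𝟘 = 0^{b+1} 𝟙 φ(p) 0^{b+1},
-- the latter a factor of φ(𝟘 p 𝟘) = 0^a 𝟙 φ(p) 0^a 𝟙 because b < a.  The factors of u_β are those of
-- the words φ^n(𝟘), each a prefix of the next and beginning with 𝟘; so φ maps a factor of u_β to a
-- factor preceded by the 𝟙 closing the previous block, giving the forward inclusions.  Conversely
-- an occurrence of 𝟙 φ(𝟙 p 𝟙) in φ(φ^n(𝟘)) starts at a block boundary and desubstitutes to one of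
-- 𝟙 p 𝟙; in 0^{b+1} 𝟙 φ(p) 0^{b+1} the blocks closing before and opening after φ(p) have more than
-- b zeros, so both are φ(𝟘).  For palindromes, reverse(𝟙 φ(p)) = 𝟙 φ(reverse p) makes reversal
-- commute with T, and T is injective.
module Submission where

open import Defs
open import Data.Nat using (ℕ; zero; suc; _+_; _≤_; _<_; _≤′_; ≤′-refl; ≤′-step; z≤n; s≤s)
open import Data.Nat.Properties
  using (≤⇒≤′; ≤-total; ≤-trans; <-trans; ≤-<-trans; <⇒≤; n<1+n; m<m+n; +-suc; +-comm;
         +-identityʳ; m≤n⇒∃[o]m+o≡n; m+n≤o⇒m≤o; >⇒≢)
open import Data.List using (List; []; _∷_; _++_; _∷ʳ_; [_]; replicate; reverse; length; map; applyUpTo; upTo; concatMap)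
open import Data.List.Properties
  using (++-assoc; ++-identityʳ; ++-cancelˡ; ++-cancelʳ; ∷-injectiveʳ; ∷ʳ-injective; concatMap-++;
         unfold-reverse; reverse-++; length-++-≤ˡ; length-++-≤ʳ; map-cong; map-upTo; map-applyUpTo)
open import Data.Product using (_×_; _,_; ∃; ∃₂)
open import Data.Sum using (_⊎_; inj₁; inj₂)
open import Data.Empty using (⊥-elim)
open import Function.Bundles using (_⇔_; mk⇔)
open import Relation.Binary.PropositionalEquality
  using (_≡_; _≢_; refl; sym; trans; cong; cong₂; subst; subst₂; module ≡-Reasoning)

open ≡-Reasoning

private variable
  A B : Set

replicate-+ : ∀ m n (x : A) → replicate (m + n) x ≡ replicate m x ++ replicate n x
replicate-+ zero    n x = refl
replicate-+ (suc m) n x = cong (x ∷_) (replicate-+ m n x)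

replicate-∷ʳ : ∀ n (x : A) → replicate n x ∷ʳ x ≡ x ∷ replicate n x
replicate-∷ʳ zero    x = refl
replicate-∷ʳ (suc n) x = cong (x ∷_) (replicate-∷ʳ n x)

reverse-replicate : ∀ n (x : A) → reverse (replicate n x) ≡ replicate n x
reverse-replicate zero    x = refl
reverse-replicate (suc n) x = begin
  reverse (x ∷ replicate n x)   ≡⟨ unfold-reverse x (replicate n x) ⟩
  reverse (replicate n x) ∷ʳ x  ≡⟨ cong (_∷ʳ x) (reverse-replicate n x) ⟩
  replicate n x ∷ʳ x            ≡⟨ replicate-∷ʳ n x ⟩
  x ∷ replicate n x             ∎

at-++ : ∀ x r {k} → k < length x → at (x ++ r) k ≡ at x k
at-++ (c ∷ x) r {zero}  _         = refl
at-++ (c ∷ x) r {suc k} (s≤s k<x) = at-++ x r k<x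

Factor : List A → List A → Set
Factor w L = ∃₂ λ x y → L ≡ x ++ w ++ y

Factor-trans : ∀ {u w L : List A} → Factor u w → Factor w L → Factor u L
Factor-trans {u = u} (x′ , y′ , refl) (x , y , refl) = x ++ x′ , y′ ++ y , (begin
  x ++ (x′ ++ u ++ y′) ++ y    ≡⟨ cong (x ++_) (++-assoc x′ (u ++ y′) y) ⟩
  x ++ x′ ++ (u ++ y′) ++ y    ≡⟨ cong (λ v → x ++ x′ ++ v) (++-assoc u y′ y) ⟩
  x ++ x′ ++ u ++ y′ ++ y      ≡⟨ ++-assoc x x′ (u ++ y′ ++ y) ⟨
  (x ++ x′) ++ u ++ y′ ++ y    ∎)

Factor-++ʳ : ∀ {w L : List A} r → Factor w L → Factor w (L ++ r)
Factor-++ʳ {w = w} r (x , y , refl) =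
  x , y ++ r , trans (++-assoc x (w ++ y) r) (cong (x ++_) (++-assoc w y r))

Factor-concatMap : ∀ (f : A → List B) {w L} → Factor w L → Factor (concatMap f w) (concatMap f L)
Factor-concatMap f {w} (x , y , refl) =
  concatMap f x , concatMap f y ,
  trans (concatMap-++ f x (w ++ y)) (cong (concatMap f x ++_) (concatMap-++ f w y))

Factor-replicate-sandwich : ∀ {k m} → k ≤ m → (x : A) (q : List A) →
  Factor (replicate k x ++ q ++ replicate k x) (replicate m x ++ q ++ replicate m x)
Factor-replicate-sandwich {k = k} k≤m x q with m≤n⇒∃[o]m+o≡n k≤m
... | d , refl = D , D , (begin
  replicate (k + d) x ++ q ++ replicate (k + d) x
    ≡⟨ cong₂ (λ l r → l ++ q ++ r) (trans (cong (λ n → replicate n x) (+-comm k d)) (replicate-+ d k x))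
                                    (replicate-+ k d x) ⟩
  (D ++ K) ++ q ++ K ++ D    ≡⟨ ++-assoc D K (q ++ K ++ D) ⟩
  D ++ K ++ q ++ K ++ D      ≡⟨ cong (λ v → D ++ K ++ v) (++-assoc q K D) ⟨
  D ++ K ++ (q ++ K) ++ D    ≡⟨ cong (D ++_) (++-assoc K (q ++ K) D) ⟨
  D ++ (K ++ q ++ K) ++ D    ∎)
  where
  D K : List _
  D = replicate d x
  K = replicate k x

factorAt-suc : ∀ u i n → factorAt u i (suc n) ≡ u i ∷ factorAt u (suc i) n
factorAt-suc u i n = cong₂ _∷_ (cong u (+-identityʳ i)) (begin
  map (λ j → u (i + j)) (applyUpTo suc n)  ≡⟨ map-applyUpTo suc (λ j → u (i + j)) n ⟩
  applyUpTo (λ j → u (i + suc j)) n         ≡⟨ map-upTo (λ j → u (i + suc j)) n ⟨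
  map (λ j → u (i + suc j)) (upTo n)        ≡⟨ map-cong (λ j → cong u (+-suc i j)) (upTo n) ⟩
  factorAt u (suc i) n                      ∎)

factorAt-cong : ∀ u v i n → (∀ k → k < i + n → u k ≡ v k) → factorAt u i n ≡ factorAt v i n
factorAt-cong u v i zero    u≈v = refl
factorAt-cong u v i (suc n) u≈v = begin
  factorAt u i (suc n)         ≡⟨ factorAt-suc u i n ⟩
  u i ∷ factorAt u (suc i) n   ≡⟨ cong₂ _∷_ (u≈v i (m<m+n i (s≤s z≤n))) (factorAt-cong u v (suc i) n u≈v′) ⟩
  v i ∷ factorAt v (suc i) n   ≡⟨ factorAt-suc v i n ⟨
  factorAt v i (suc n)         ∎
  where
  u≈v′ : ∀ k → k < suc i + n → u k ≡ v k
  u≈v′ k k< = u≈v k (subst (k <_) (sym (+-suc i n)) k<)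

-- factorAt (at (c ∷ L)) (suc i) n and factorAt (at L) i n are definitionally equal.
factorAt-at : ∀ x w y → factorAt (at (x ++ w ++ y)) (length x) (length w) ≡ w
factorAt-at (c ∷ x) w       y = factorAt-at x w y
factorAt-at []      []      y = refl
factorAt-at []      (c ∷ w) y =
  trans (factorAt-suc (at (c ∷ w ++ y)) 0 (length w)) (cong (c ∷_) (factorAt-at [] w y))

factorAt-at-prefix : ∀ L n → n ≤ length L → ∃ λ y → L ≡ factorAt (at L) 0 n ++ y
factorAt-at-prefix L       zero    _        = L , refl
factorAt-at-prefix (c ∷ L) (suc n) (s≤s n≤) =
  let y , L≡ = factorAt-at-prefix L n n≤
  in  y , trans (cong (c ∷_) L≡) (cong (_++ y) (sym (factorAt-suc (at (c ∷ L)) 0 n)))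

Factor-factorAt-at : ∀ L i n → i + n ≤ length L → Factor (factorAt (at L) i n) L
Factor-factorAt-at L       zero    n i+n≤ = let y , L≡ = factorAt-at-prefix L n i+n≤ in [] , y , L≡
Factor-factorAt-at (c ∷ L) (suc i) n (s≤s i+n≤) =
  let x , y , L≡ = Factor-factorAt-at L i n i+n≤ in c ∷ x , y , cong (c ∷_) L≡

length-factor : ∀ (x w y : List A) → length x + length w ≤ length (x ++ w ++ y)
length-factor []      w y = length-++-≤ˡ w
length-factor (c ∷ x) w y = s≤s (length-factor x w y)

module PrefixLimit (P : ℕ → Word)
                   (P-extends : ∀ n → ∃ λ r → P (suc n) ≡ P n ++ r)
                   (P-long : ∀ n → n < length (P n)) where

  lim : ℕ → Letter
  lim k = at (P (suc k)) k

  P-mono : ∀ {m n} → m ≤′ n → ∃ λ r → P n ≡ P m ++ r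
  P-mono ≤′-refl = [] , sym (++-identityʳ _)
  P-mono {m} (≤′-step {n} m≤′n) =
    let r , Pn≡ = P-mono m≤′n
        r′ , P1+n≡ = P-extends n
    in  r ++ r′ , (begin
      P (suc n)        ≡⟨ P1+n≡ ⟩
      P n ++ r′        ≡⟨ cong (_++ r′) Pn≡ ⟩
      (P m ++ r) ++ r′ ≡⟨ ++-assoc (P m) r r′ ⟩
      P m ++ r ++ r′   ∎)

  at-P-mono : ∀ {m n k} → m ≤ n → k < length (P m) → at (P n) k ≡ at (P m) k
  at-P-mono {m} {k = k} m≤n k< =
    let r , Pn≡ = P-mono (≤⇒≤′ m≤n) in trans (cong (λ L → at L k) Pn≡) (at-++ (P m) r k<)

  lim-at : ∀ n {k} → k < length (P n) → lim k ≡ at (P n) k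
  lim-at n {k} k< with ≤-total (suc k) n
  ... | inj₁ 1+k≤n = sym (at-P-mono 1+k≤n (<-trans (n<1+n k) (P-long (suc k))))
  ... | inj₂ n≤1+k = at-P-mono n≤1+k k<

  ∈𝓛⇒Factor : ∀ {w} → w ∈𝓛 lim → ∃ λ N → Factor w (P N)
  ∈𝓛⇒Factor {w} (i , w≡) =
    N , subst (λ v → Factor v (P N)) (sym w≡′) (Factor-factorAt-at (P N) i (length w) (<⇒≤ (P-long N)))
    where
    N = i + length w
    w≡′ : w ≡ factorAt (at (P N)) i (length w)
    w≡′ = trans w≡ (factorAt-cong lim (at (P N)) i (length w) (λ k k< → lim-at N (<-trans k< (P-long N))))

  Factor⇒∈𝓛 : ∀ {w} N → Factor w (P N) → w ∈𝓛 lim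
  Factor⇒∈𝓛 {w} N (x , y , PN≡) = length x , sym (begin
    factorAt lim (length x) (length w)                ≡⟨ factorAt-cong _ _ (length x) (length w) lim≈ ⟩
    factorAt (at (P N)) (length x) (length w)         ≡⟨ cong (λ L → factorAt (at L) (length x) (length w)) PN≡ ⟩
    factorAt (at (x ++ w ++ y)) (length x) (length w) ≡⟨ factorAt-at x w y ⟩
    w                                                 ∎)
    where
    lim≈ : ∀ k → k < length x + length w → lim k ≡ at (P N) k
    lim≈ k k< = lim-at N (≤-trans k< (subst (λ L → length x + length w ≤ length L) (sym PN≡) (length-factor x w y)))

infix 8 𝟘^_
𝟘^_ : ℕ → Word
𝟘^ k = replicate k 𝟘

𝟘^𝟙≢[] : ∀ k {r} → 𝟘^ k ++ 𝟙 ∷ r ≢ []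
𝟘^𝟙≢[] zero    ()
𝟘^𝟙≢[] (suc k) ()

𝟘^𝟙≢𝟘∷𝟘^ : ∀ k {r y} → 𝟘^ k ++ 𝟙 ∷ r ≢ 𝟘 ∷ 𝟘^ k ++ y
𝟘^𝟙≢𝟘∷𝟘^ zero    ()
𝟘^𝟙≢𝟘∷𝟘^ (suc k) e = 𝟘^𝟙≢𝟘∷𝟘^ k (∷-injectiveʳ e)

𝟘^𝟙-injective : ∀ k m {r r′} → 𝟘^ k ++ 𝟙 ∷ r ≡ 𝟘^ m ++ 𝟙 ∷ r′ → k ≡ m × r ≡ r′
𝟘^𝟙-injective zero    zero    e = refl , ∷-injectiveʳ e
𝟘^𝟙-injective (suc k) (suc m) e = let k≡m , r≡r′ = 𝟘^𝟙-injective k m (∷-injectiveʳ e) in cong suc k≡m , r≡r′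

𝟘^𝟙-split : ∀ k {r} x {t} → 𝟘^ k ++ 𝟙 ∷ r ≡ x ++ 𝟙 ∷ t →
            (x ≡ 𝟘^ k × r ≡ t) ⊎ ∃ λ x′ → x ≡ 𝟘^ k ++ 𝟙 ∷ x′ × r ≡ x′ ++ 𝟙 ∷ t
𝟘^𝟙-split zero    []      refl = inj₁ (refl , refl)
𝟘^𝟙-split zero    (𝟙 ∷ x) refl = inj₂ (x , refl , refl)
𝟘^𝟙-split (suc k) (𝟘 ∷ x) e with 𝟘^𝟙-split k x (∷-injectiveʳ e)
... | inj₁ (x≡ , r≡)      = inj₁ (cong (𝟘 ∷_) x≡ , r≡)
... | inj₂ (x′ , x≡ , r≡) = inj₂ (x′ , cong (𝟘 ∷_) x≡ , r≡)

module Morphism (a b : ℕ) where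

  exponent : Letter → ℕ
  exponent 𝟘 = a
  exponent 𝟙 = b

  φ-letter-++ : ∀ c r → φ-letter a b c ++ r ≡ 𝟘^ exponent c ++ 𝟙 ∷ r
  φ-letter-++ 𝟘 r = ++-assoc (𝟘^ a) [ 𝟙 ] r
  φ-letter-++ 𝟙 r = ++-assoc (𝟘^ b) [ 𝟙 ] r

  φ-∷ : ∀ c v → φ a b (c ∷ v) ≡ 𝟘^ exponent c ++ 𝟙 ∷ φ a b v
  φ-∷ c v = φ-letter-++ c (φ a b v)

  φ-∷-++ : ∀ c v y → φ a b (c ∷ v) ++ y ≡ 𝟘^ exponent c ++ 𝟙 ∷ φ a b v ++ y
  φ-∷-++ c v y = trans (++-assoc (φ-letter a b c) (φ a b v) y) (φ-letter-++ c (φ a b v ++ y))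

  φ-[_] : ∀ c → φ a b [ c ] ≡ 𝟘^ exponent c ∷ʳ 𝟙
  φ-[ c ] = φ-letter-++ c []

  φ-++ : ∀ u v → φ a b (u ++ v) ≡ φ a b u ++ φ a b v
  φ-++ = concatMap-++ (φ-letter a b)

  exponent-injective : a ≢ b → ∀ {c d} → exponent c ≡ exponent d → c ≡ d
  exponent-injective a≢b {𝟘} {𝟘} _   = refl
  exponent-injective a≢b {𝟙} {𝟙} _   = refl
  exponent-injective a≢b {𝟘} {𝟙} a≡b = ⊥-elim (a≢b a≡b)
  exponent-injective a≢b {𝟙} {𝟘} b≡a = ⊥-elim (a≢b (sym b≡a))

  length-φ : ∀ v → length v ≤ length (φ a b v)
  length-φ []      = z≤n
  length-φ (c ∷ v) = subst (λ l → suc (length v) ≤ length l) (sym (φ-∷ c v))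
                       (≤-trans (s≤s (length-φ v)) (length-++-≤ʳ (𝟙 ∷ φ a b v) {𝟘^ exponent c}))

  φ-ends-with-𝟙 : ∀ c v → ∃ λ s → φ a b (c ∷ v) ≡ s ∷ʳ 𝟙
  φ-ends-with-𝟙 c []      = 𝟘^ exponent c , φ-[ c ]
  φ-ends-with-𝟙 c (d ∷ v) = let s , φdv≡ = φ-ends-with-𝟙 d v in φ-letter a b c ++ s , (begin
    φ-letter a b c ++ φ a b (d ∷ v)  ≡⟨ cong (φ-letter a b c ++_) φdv≡ ⟩
    φ-letter a b c ++ s ∷ʳ 𝟙         ≡⟨ ++-assoc (φ-letter a b c) s [ 𝟙 ] ⟨
    (φ-letter a b c ++ s) ∷ʳ 𝟙       ∎)

  φ≢∷ʳ𝟘 : ∀ v x → φ a b v ≢ x ∷ʳ 𝟘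
  φ≢∷ʳ𝟘 []      []      ()
  φ≢∷ʳ𝟘 []      (_ ∷ _) ()
  φ≢∷ʳ𝟘 (c ∷ v) x φcv≡ with φ-ends-with-𝟙 c v
  ... | s , φcv≡′ with ∷ʳ-injective s x (trans (sym φcv≡′) φcv≡)
  ...   | _ , ()

  φ≡[]⇒≡[] : ∀ v → φ a b v ≡ [] → v ≡ []
  φ≡[]⇒≡[] []      _     = refl
  φ≡[]⇒≡[] (c ∷ v) φcv≡ = ⊥-elim (𝟘^𝟙≢[] (exponent c) (trans (sym (φ-∷ c v)) φcv≡))

  φ-prefix : a ≢ b → ∀ v w {y} → φ a b v ≡ φ a b w ++ y → ∃ λ v′ → v ≡ w ++ v′ × φ a b v′ ≡ y
  φ-prefix a≢b v       []      φv≡ = v , refl , φv≡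
  φ-prefix a≢b []      (d ∷ w) {y} φv≡ = ⊥-elim (𝟘^𝟙≢[] (exponent d) (sym (trans φv≡ (φ-∷-++ d w y))))
  φ-prefix a≢b (c ∷ v) (d ∷ w) {y} φv≡
    with 𝟘^𝟙-injective (exponent c) (exponent d) (trans (sym (φ-∷ c v)) (trans φv≡ (φ-∷-++ d w y)))
  ... | ec≡ed , φv≡′ with exponent-injective a≢b ec≡ed
  ... | refl = let v′ , v≡ , φv′≡ = φ-prefix a≢b v w φv≡′ in v′ , cong (c ∷_) v≡ , φv′≡

  φ-injective : a ≢ b → ∀ p q → φ a b p ≡ φ a b q → p ≡ q
  φ-injective a≢b p q φp≡φq =
    let v′ , p≡ , φv′≡[] = φ-prefix a≢b p q (trans φp≡φq (sym (++-identityʳ _)))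
    in  trans p≡ (trans (cong (q ++_) (φ≡[]⇒≡[] v′ φv′≡[])) (++-identityʳ q))

  φ-split-at-𝟙 : ∀ V x {t} → φ a b V ≡ x ++ 𝟙 ∷ t →
    ∃₂ λ v₁ c → ∃ λ v₂ → V ≡ v₁ ++ c ∷ v₂ × x ≡ φ a b v₁ ++ 𝟘^ exponent c × φ a b v₂ ≡ t
  φ-split-at-𝟙 []      []      ()
  φ-split-at-𝟙 []      (_ ∷ _) ()
  φ-split-at-𝟙 (c ∷ V) x φV≡ with 𝟘^𝟙-split (exponent c) x (trans (sym (φ-∷ c V)) φV≡)
  ... | inj₁ (x≡ , φV≡′) = [] , c , V , refl , x≡ , φV≡′
  ... | inj₂ (x′ , x≡ , φV≡′) =
    let v₁ , c′ , v₂ , V≡ , x′≡ , φv₂≡ = φ-split-at-𝟙 V x′ φV≡′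
    in  c ∷ v₁ , c′ , v₂ , cong (c ∷_) V≡ , (begin
      x                                                      ≡⟨ x≡ ⟩
      𝟘^ exponent c ++ 𝟙 ∷ x′                                ≡⟨ cong (λ s → 𝟘^ exponent c ++ 𝟙 ∷ s) x′≡ ⟩
      𝟘^ exponent c ++ 𝟙 ∷ φ a b v₁ ++ 𝟘^ exponent c′        ≡⟨ φ-∷-++ c v₁ _ ⟨
      φ a b (c ∷ v₁) ++ 𝟘^ exponent c′                       ∎) , φv₂≡

  reverse-𝟙∷φ : ∀ p → reverse (𝟙 ∷ φ a b p) ≡ 𝟙 ∷ φ a b (reverse p)
  reverse-𝟙∷φ []      = refl
  reverse-𝟙∷φ (c ∷ p) = begin
    reverse (𝟙 ∷ φ a b (c ∷ p))                         ≡⟨ cong (λ s → reverse (𝟙 ∷ s)) (φ-∷ c p) ⟩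
    reverse ((𝟙 ∷ 𝟘^ exponent c) ++ 𝟙 ∷ φ a b p)        ≡⟨ reverse-++ (𝟙 ∷ 𝟘^ exponent c) (𝟙 ∷ φ a b p) ⟩
    reverse (𝟙 ∷ φ a b p) ++ reverse (𝟙 ∷ 𝟘^ exponent c) ≡⟨ cong₂ _++_ (reverse-𝟙∷φ p) reverse-𝟙∷𝟘^ ⟩
    𝟙 ∷ φ a b (reverse p) ++ 𝟘^ exponent c ∷ʳ 𝟙         ≡⟨ cong (λ s → 𝟙 ∷ φ a b (reverse p) ++ s) φ-[ c ] ⟨
    𝟙 ∷ φ a b (reverse p) ++ φ a b [ c ]                ≡⟨ cong (𝟙 ∷_) (φ-++ (reverse p) [ c ]) ⟨
    𝟙 ∷ φ a b (reverse p ∷ʳ c)                          ≡⟨ cong (λ s → 𝟙 ∷ φ a b s) (unfold-reverse c p) ⟨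
    𝟙 ∷ φ a b (reverse (c ∷ p))                         ∎
    where
    reverse-𝟙∷𝟘^ : reverse (𝟙 ∷ 𝟘^ exponent c) ≡ 𝟘^ exponent c ∷ʳ 𝟙
    reverse-𝟙∷𝟘^ = trans (unfold-reverse 𝟙 (𝟘^ exponent c)) (cong (_∷ʳ 𝟙) (reverse-replicate (exponent c) 𝟘))

  reverse-T : ∀ p → reverse (T a b p) ≡ T a b (reverse p)
  reverse-T p = begin
    reverse (𝟘^ b ++ (𝟙 ∷ φ a b p) ++ 𝟘^ b)               ≡⟨ reverse-++ (𝟘^ b) _ ⟩
    reverse ((𝟙 ∷ φ a b p) ++ 𝟘^ b) ++ reverse (𝟘^ b)     ≡⟨ cong (_++ reverse (𝟘^ b)) (reverse-++ (𝟙 ∷ φ a b p) (𝟘^ b)) ⟩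
    (reverse (𝟘^ b) ++ reverse (𝟙 ∷ φ a b p)) ++ reverse (𝟘^ b)
      ≡⟨ cong₂ (λ z s → (z ++ s) ++ z) (reverse-replicate b 𝟘) (reverse-𝟙∷φ p) ⟩
    (𝟘^ b ++ 𝟙 ∷ φ a b (reverse p)) ++ 𝟘^ b               ≡⟨ ++-assoc (𝟘^ b) _ (𝟘^ b) ⟩
    T a b (reverse p)                                     ∎

  T-injective : a ≢ b → ∀ p q → T a b p ≡ T a b q → p ≡ q
  T-injective a≢b p q Tp≡Tq =
    φ-injective a≢b p q (∷-injectiveʳ (++-cancelʳ (𝟘^ b) _ _ (++-cancelˡ (𝟘^ b) _ _ Tp≡Tq)))

  Palindrome⇔Palindrome-T : a ≢ b → ∀ p → Palindrome p ⇔ Palindrome (T a b p)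
  Palindrome⇔Palindrome-T a≢b p = mk⇔
    (λ p≡ → trans (cong (T a b) p≡) (sym (reverse-T p)))
    (λ Tp≡ → T-injective a≢b p (reverse p) (trans Tp≡ (reverse-T p)))

  T-∷ʳ : ∀ p z → T a b p ∷ʳ z ≡ 𝟘^ b ++ 𝟙 ∷ φ a b p ++ 𝟘^ b ∷ʳ z
  T-∷ʳ p z = trans (++-assoc (𝟘^ b) _ [ z ]) (cong (λ s → 𝟘^ b ++ 𝟙 ∷ s) (++-assoc (φ a b p) (𝟘^ b) [ z ]))

  𝟙T𝟙≡𝟙φ𝟙p𝟙 : ∀ p → 𝟙 ∷ T a b p ∷ʳ 𝟙 ≡ 𝟙 ∷ φ a b (𝟙 ∷ p ∷ʳ 𝟙)
  𝟙T𝟙≡𝟙φ𝟙p𝟙 p = cong (𝟙 ∷_) (begin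
    T a b p ∷ʳ 𝟙                          ≡⟨ T-∷ʳ p 𝟙 ⟩
    𝟘^ b ++ 𝟙 ∷ φ a b p ++ 𝟘^ b ∷ʳ 𝟙      ≡⟨ cong (λ s → 𝟘^ b ++ 𝟙 ∷ φ a b p ++ s) φ-[ 𝟙 ] ⟨
    𝟘^ b ++ 𝟙 ∷ φ a b p ++ φ a b [ 𝟙 ]    ≡⟨ cong (λ s → 𝟘^ b ++ 𝟙 ∷ s) (φ-++ p [ 𝟙 ]) ⟨
    𝟘^ b ++ 𝟙 ∷ φ a b (p ∷ʳ 𝟙)            ≡⟨ φ-∷ 𝟙 (p ∷ʳ 𝟙) ⟨
    φ a b (𝟙 ∷ p ∷ʳ 𝟙)                    ∎)

  𝟘T𝟘≡ : ∀ p → 𝟘 ∷ T a b p ∷ʳ 𝟘 ≡ 𝟘^ suc b ++ (𝟙 ∷ φ a b p) ++ 𝟘^ suc b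
  𝟘T𝟘≡ p = cong (𝟘 ∷_) (trans (T-∷ʳ p 𝟘) (cong (λ s → 𝟘^ b ++ 𝟙 ∷ φ a b p ++ s) (replicate-∷ʳ b 𝟘)))

  φ𝟘p𝟘≡ : ∀ p → φ a b (𝟘 ∷ p ∷ʳ 𝟘) ≡ (𝟘^ a ++ (𝟙 ∷ φ a b p) ++ 𝟘^ a) ∷ʳ 𝟙
  φ𝟘p𝟘≡ p = begin
    φ a b (𝟘 ∷ p ∷ʳ 𝟘)                    ≡⟨ φ-∷ 𝟘 (p ∷ʳ 𝟘) ⟩
    𝟘^ a ++ 𝟙 ∷ φ a b (p ∷ʳ 𝟘)            ≡⟨ cong (λ s → 𝟘^ a ++ 𝟙 ∷ s) (φ-++ p [ 𝟘 ]) ⟩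
    𝟘^ a ++ 𝟙 ∷ φ a b p ++ φ a b [ 𝟘 ]    ≡⟨ cong (λ s → 𝟘^ a ++ 𝟙 ∷ φ a b p ++ s) φ-[ 𝟘 ] ⟩
    𝟘^ a ++ 𝟙 ∷ φ a b p ++ 𝟘^ a ∷ʳ 𝟙      ≡⟨ T-shape ⟨
    (𝟘^ a ++ (𝟙 ∷ φ a b p) ++ 𝟘^ a) ∷ʳ 𝟙  ∎
    where
    T-shape : (𝟘^ a ++ (𝟙 ∷ φ a b p) ++ 𝟘^ a) ∷ʳ 𝟙 ≡ 𝟘^ a ++ 𝟙 ∷ φ a b p ++ 𝟘^ a ∷ʳ 𝟙
    T-shape = trans (++-assoc (𝟘^ a) _ [ 𝟙 ]) (cong (λ s → 𝟘^ a ++ 𝟙 ∷ s) (++-assoc (φ a b p) (𝟘^ a) [ 𝟙 ]))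

  Factor-𝟘T𝟘-φ𝟘p𝟘 : b < a → ∀ p → Factor (𝟘 ∷ T a b p ∷ʳ 𝟘) (φ a b (𝟘 ∷ p ∷ʳ 𝟘))
  Factor-𝟘T𝟘-φ𝟘p𝟘 b<a p = subst₂ Factor (sym (𝟘T𝟘≡ p)) (sym (φ𝟘p𝟘≡ p))
    (Factor-++ʳ [ 𝟙 ] (Factor-replicate-sandwich b<a 𝟘 (𝟙 ∷ φ a b p)))

  Factor-𝟙p𝟙⇒Factor-𝟙T𝟙 : ∀ p {L} → Factor (𝟙 ∷ p ∷ʳ 𝟙) (𝟘 ∷ L) → Factor (𝟙 ∷ T a b p ∷ʳ 𝟙) (φ a b (𝟘 ∷ L))
  Factor-𝟙p𝟙⇒Factor-𝟙T𝟙 p {L} (c ∷ x , y , L≡) =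
    let s , φcx≡ = φ-ends-with-𝟙 c x in s , φ a b y , (begin
      φ a b (𝟘 ∷ L)                          ≡⟨ cong (φ a b) L≡ ⟩
      φ a b ((c ∷ x) ++ w ++ y)              ≡⟨ φ-++ (c ∷ x) (w ++ y) ⟩
      φ a b (c ∷ x) ++ φ a b (w ++ y)        ≡⟨ cong (φ a b (c ∷ x) ++_) (φ-++ w y) ⟩
      φ a b (c ∷ x) ++ φ a b w ++ φ a b y    ≡⟨ cong (_++ φ a b w ++ φ a b y) φcx≡ ⟩
      (s ∷ʳ 𝟙) ++ φ a b w ++ φ a b y         ≡⟨ ++-assoc s [ 𝟙 ] _ ⟩
      s ++ (𝟙 ∷ φ a b w) ++ φ a b y          ≡⟨ cong (λ v → s ++ v ++ φ a b y) (𝟙T𝟙≡𝟙φ𝟙p𝟙 p) ⟨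
      s ++ (𝟙 ∷ T a b p ∷ʳ 𝟙) ++ φ a b y     ∎)
    where
    w = 𝟙 ∷ p ∷ʳ 𝟙

  Factor-𝟘p𝟘⇒Factor-𝟘T𝟘 : b < a → ∀ p {L} → Factor (𝟘 ∷ p ∷ʳ 𝟘) L → Factor (𝟘 ∷ T a b p ∷ʳ 𝟘) (φ a b L)
  Factor-𝟘p𝟘⇒Factor-𝟘T𝟘 b<a p 𝟘p𝟘⊑L = Factor-trans (Factor-𝟘T𝟘-φ𝟘p𝟘 b<a p) (Factor-concatMap (φ-letter a b) 𝟘p𝟘⊑L)

  Factor-𝟙T𝟙⇒Factor-𝟙p𝟙 : a ≢ b → ∀ p {L} → Factor (𝟙 ∷ T a b p ∷ʳ 𝟙) (φ a b L) → Factor (𝟙 ∷ p ∷ʳ 𝟙) L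
  Factor-𝟙T𝟙⇒Factor-𝟙p𝟙 a≢b p {L} (x , y , φL≡) =
    let v₁ , c , v₂ , L≡ , _ , φv₂≡ = φ-split-at-𝟙 L x (trans φL≡ (cong (λ v → x ++ v ++ y) (𝟙T𝟙≡𝟙φ𝟙p𝟙 p)))
        v′ , v₂≡ , _ = φ-prefix a≢b v₂ w φv₂≡
    in  v₁ ∷ʳ c , v′ , (begin
      L                    ≡⟨ L≡ ⟩
      v₁ ++ c ∷ v₂         ≡⟨ cong (λ v → v₁ ++ c ∷ v) v₂≡ ⟩
      v₁ ++ c ∷ w ++ v′    ≡⟨ ++-assoc v₁ [ c ] (w ++ v′) ⟨
      (v₁ ∷ʳ c) ++ w ++ v′ ∎)
    where
    w = 𝟙 ∷ p ∷ʳ 𝟙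

  closing-block-𝟘 : ∀ x v c → x ++ 𝟘^ suc b ≡ φ a b v ++ 𝟘^ exponent c → c ≡ 𝟘
  closing-block-𝟘 x v 𝟘 _     = refl
  closing-block-𝟘 x v 𝟙 x𝟘^≡ =
    ⊥-elim (φ≢∷ʳ𝟘 v x (sym (++-cancelʳ (𝟘^ b) (x ∷ʳ 𝟘) (φ a b v) (trans (++-assoc x [ 𝟘 ] (𝟘^ b)) x𝟘^≡))))

  opening-block-𝟘 : ∀ v {y} → φ a b v ≡ 𝟘^ suc b ++ y → ∃ λ v′ → v ≡ 𝟘 ∷ v′
  opening-block-𝟘 (𝟘 ∷ v) _   = v , refl
  opening-block-𝟘 (𝟙 ∷ v) φv≡ = ⊥-elim (𝟘^𝟙≢𝟘∷𝟘^ b (trans (sym (φ-∷ 𝟙 v)) φv≡))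
  opening-block-𝟘 []      ()

  𝟘T𝟘-in-context : ∀ p x y → x ++ (𝟘 ∷ T a b p ∷ʳ 𝟘) ++ y ≡ (x ++ 𝟘^ suc b) ++ 𝟙 ∷ φ a b p ++ 𝟘^ suc b ++ y
  𝟘T𝟘-in-context p x y = begin
    x ++ (𝟘 ∷ T a b p ∷ʳ 𝟘) ++ y            ≡⟨ cong (λ v → x ++ v ++ y) (𝟘T𝟘≡ p) ⟩
    x ++ (Z ++ (𝟙 ∷ φ a b p) ++ Z) ++ y     ≡⟨ cong (x ++_) (++-assoc Z _ y) ⟩
    x ++ Z ++ ((𝟙 ∷ φ a b p) ++ Z) ++ y     ≡⟨ ++-assoc x Z _ ⟨
    (x ++ Z) ++ 𝟙 ∷ (φ a b p ++ Z) ++ y     ≡⟨ cong (λ s → (x ++ Z) ++ 𝟙 ∷ s) (++-assoc (φ a b p) Z y) ⟩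
    (x ++ Z) ++ 𝟙 ∷ φ a b p ++ Z ++ y       ∎
    where
    Z = 𝟘^ suc b

  Factor-𝟘T𝟘⇒Factor-𝟘p𝟘 : a ≢ b → ∀ p {L} → Factor (𝟘 ∷ T a b p ∷ʳ 𝟘) (φ a b L) → Factor (𝟘 ∷ p ∷ʳ 𝟘) L
  Factor-𝟘T𝟘⇒Factor-𝟘p𝟘 a≢b p {L} (x , y , φL≡)
    with φ-split-at-𝟙 L (x ++ 𝟘^ suc b) (trans φL≡ (𝟘T𝟘-in-context p x y))
  ... | v₁ , c , v₂ , L≡ , x𝟘^≡ , φv₂≡ with closing-block-𝟘 x v₁ c x𝟘^≡
  ... | refl with φ-prefix a≢b v₂ p φv₂≡
  ... | v′ , v₂≡ , φv′≡ with opening-block-𝟘 v′ φv′≡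
  ... | v″ , refl = v₁ , v″ , (begin
    L                         ≡⟨ L≡ ⟩
    v₁ ++ 𝟘 ∷ v₂              ≡⟨ cong (λ v → v₁ ++ 𝟘 ∷ v) v₂≡ ⟩
    v₁ ++ 𝟘 ∷ p ++ 𝟘 ∷ v″     ≡⟨ cong (λ v → v₁ ++ 𝟘 ∷ v) (++-assoc p [ 𝟘 ] v″) ⟨
    v₁ ++ (𝟘 ∷ p ∷ʳ 𝟘) ++ v″  ∎)

module FixedPoint (a′ b : ℕ) where

  open Morphism (suc a′) b

  U : ℕ → Word
  U n = φ^ (suc a′) b n [ 𝟘 ]

  U-starts-𝟘 : ∀ n → ∃ λ s → U n ≡ 𝟘 ∷ s
  U-starts-𝟘 zero    = [] , refl
  U-starts-𝟘 (suc n) = let s , Un≡ = U-starts-𝟘 n in _ , trans (cong (φ (suc a′) b) Un≡) (φ-∷ 𝟘 s)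

  U-extends : ∀ n → ∃ λ r → U (suc n) ≡ U n ++ r
  U-extends zero    = _ , refl
  U-extends (suc n) = let r , U1+n≡ = U-extends n in
    φ (suc a′) b r , trans (cong (φ (suc a′) b) U1+n≡) (φ-++ (U n) r)

  length-𝟘∷-<-φ : ∀ s → length (𝟘 ∷ s) < length (φ (suc a′) b (𝟘 ∷ s))
  length-𝟘∷-<-φ s = subst (λ l → length (𝟘 ∷ s) < length l) (sym (φ-∷ 𝟘 s))
    (s≤s (≤-trans (s≤s (length-φ s)) (length-++-≤ʳ (𝟙 ∷ φ (suc a′) b s) {𝟘^ a′})))

  U-long : ∀ n → n < length (U n)
  U-long zero    = s≤s z≤n
  U-long (suc n) = let s , Un≡ = U-starts-𝟘 n in
    ≤-<-trans (U-long n) (subst (λ L → length L < length (φ (suc a′) b L)) (sym Un≡) (length-𝟘∷-<-φ s))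

  -- lim is uβ (suc a′) b by definition.
  open PrefixLimit U U-extends U-long

  ∈𝓛-substitute : ∀ {w w′} → (∀ {s} → Factor w (𝟘 ∷ s) → Factor w′ (φ (suc a′) b (𝟘 ∷ s))) →
                  w ∈𝓛 uβ (suc a′) b → w′ ∈𝓛 uβ (suc a′) b
  ∈𝓛-substitute {w} {w′} transfer w∈ =
    let N , w⊑UN = ∈𝓛⇒Factor w∈
        s , UN≡ = U-starts-𝟘 N
    in  Factor⇒∈𝓛 (suc N) (subst (λ L → Factor w′ (φ (suc a′) b L)) (sym UN≡) (transfer (subst (Factor w) UN≡ w⊑UN)))

  ∈𝓛-desubstitute : ∀ {w w′} → (∀ {L} → Factor w′ (φ (suc a′) b L) → Factor w L) →
                    w′ ∈𝓛 uβ (suc a′) b → w ∈𝓛 uβ (suc a′) b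
  ∈𝓛-desubstitute transfer w′∈ =
    let N , w′⊑UN = ∈𝓛⇒Factor w′∈
        r , U1+N≡ = U-extends N
    in  Factor⇒∈𝓛 N (transfer (subst (Factor _) (sym U1+N≡) (Factor-++ʳ r w′⊑UN)))

lemma5p3 : (a b : ℕ) → b + 1 < a → 1 ≤ b → (p : Word) → p ∈𝓛 uβ a b →
    (Palindrome p ⇔ Palindrome (T a b p))
    × ((z : Letter) → ((z ∷ p ++ z ∷ []) ∈𝓛 uβ a b) ⇔ ((z ∷ T a b p ++ z ∷ []) ∈𝓛 uβ a b))
lemma5p3 zero       b ()    _ _ _
lemma5p3 a@(suc a′) b b+1<a _ p _ =
  Palindrome⇔Palindrome-T a≢b p ,
  λ { 𝟘 → mk⇔ (∈𝓛-substitute (Factor-𝟘p𝟘⇒Factor-𝟘T𝟘 b<a p)) (∈𝓛-desubstitute (Factor-𝟘T𝟘⇒Factor-𝟘p𝟘 a≢b p))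
    ; 𝟙 → mk⇔ (∈𝓛-substitute (Factor-𝟙p𝟙⇒Factor-𝟙T𝟙 p)) (∈𝓛-desubstitute (Factor-𝟙T𝟙⇒Factor-𝟙p𝟙 a≢b p)) }
  where
  open Morphism a b
  open FixedPoint a′ b
  b<a : b < a
  b<a = m+n≤o⇒m≤o (suc b) b+1<a
  a≢b : a ≢ b
  a≢b = >⇒≢ b<a
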